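{- Let $H$ be a group and $K\subseteq H$ a subset such that $H\setminus K$ is a connection set of $H$, and let $\mathcal{H}$ be an $H$-regular $1$-factorization of $Cay[H:H\setminus K]$ (with $H$ acting by right translation). Let $G=G_1\times H$ for some group $G_1$, regarding $G_1$ and $H$ as the subgroups $G_1\times\{0\}$ and $\{0\}\times H$ of $G$. Then there exists a $G$-regular $1$-factorization (with $G$ acting by right translation) of $Cay[G:H\setminus K]$ containing $\mathcal{H}$ as a subfactorization.
   Context: Groups are written additively and need not be abelian. A connection set of a group $X$ is a subset $S\subseteq X\setminus\{0\}$ with $S=-S$; $Cay[X:S]$ is the graph with vertex set $X$ in which $x,y$ are adjacent iff $x-y\in S$. For a graph $\Gamma$ with vertices in $X$ and $g\in X$, the right translate $\Gamma+g$ is obtained by replacing each vertex $x$ by $x+g$. A $1$-factor of a graph is a spanning subgraph in which every vertex has degree exactly $1$; a $1$-factorization is a set of $1$-factors whose edge sets partition the edge set. A $1$-factorization $\mathcal{F}$ of a graph on vertex set $X$ is $X$-regular under right translation if $F+g\in\mathcal{F}$ for every $F\in\mathcal{F}$ and $g\in X$. A $1$-factorization $\mathcal{G}$ contains $\mathcal{H}$ as a subfactorization if for every $F\in\mathcal{H}$ and $\Gamma\in\mathcal{G}$, either $F\subseteq\Gamma$ or $F$ and $\Gamma$ share no edge. -}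

module Defs where

open import Data.Product using (Σ; ∃; ∃-syntax; ∃!; _×_; _,_; proj₁; proj₂)
open import Relation.Binary.PropositionalEquality
open import Relation.Nullary using (¬_)
open import Algebra.Structures using (IsGroup; IsMonoid; IsSemigroup; IsMagma)

record Grp : Set₁ where
  infixl 6 _+_
  field
    Carrier : Set
    _+_     : Carrier → Carrier → Carrier
    𝟘       : Carrier
    -_      : Carrier → Carrier
    isGroup : IsGroup _≡_ _+_ 𝟘 -_

  _-_ : Carrier → Carrier → Carrier
  x - y = x + (- y)

_×ᴳ_ : Grp → Grp → Grp
A ×ᴳ B = record
  { Carrier = A.Carrier × B.Carrier
  ; _+_ = λ { (a , b) (a' , b') → (a A.+ a') , (b B.+ b') }
  ; 𝟘 = A.𝟘 , B.𝟘
  ; -_ = λ { (a , b) → (A.- a) , (B.- b) }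
  ; isGroup = record
    { isMonoid = record
      { isSemigroup = record
        { isMagma = record
          { isEquivalence = isEquivalence
          ; ∙-cong = λ { refl refl → refl } }
        ; assoc = λ { (a , b) (c , d) (e , f) →
            cong₂ _,_ (IA.assoc a c e) (IB.assoc b d f) } }
      ; identity = (λ { (a , b) → cong₂ _,_ (IA.identityˡ a) (IB.identityˡ b) })
                 , (λ { (a , b) → cong₂ _,_ (IA.identityʳ a) (IB.identityʳ b) }) }
    ; inverse = (λ { (a , b) → cong₂ _,_ (IA.inverseˡ a) (IB.inverseˡ b) })
              , (λ { (a , b) → cong₂ _,_ (IA.inverseʳ a) (IB.inverseʳ b) })
    ; ⁻¹-cong = λ { refl → refl } } }
  where
    module A = Grp A
    module B = Grp B
    module IA = IsGroup A.isGroup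
    module IB = IsGroup B.isGroup

ι₂ : (G₁ H : Grp) → Grp.Carrier H → Grp.Carrier (G₁ ×ᴳ H)
ι₂ G₁ H h = Grp.𝟘 G₁ , h

Graph : Set → Set₁
Graph X = X → X → Set

_⊆ᴱ_ : {X : Set} → Graph X → Graph X → Set
F ⊆ᴱ Γ = ∀ x y → F x y → Γ x y

_≐ᴱ_ : {X : Set} → Graph X → Graph X → Set
F ≐ᴱ Γ = (F ⊆ᴱ Γ) × (Γ ⊆ᴱ F)

module _ (X : Grp) where
  open Grp X

  IsConnectionSet : (Carrier → Set) → Set
  IsConnectionSet S = (∀ x → S x → ¬ (x ≡ 𝟘))
                    × (∀ x → (S x → S (- x)) × (S (- x) → S x))

  Cay : (Carrier → Set) → Graph Carrier
  Cay S x y = S (x - y)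

  -- Right translate Γ + g: vertex x replaced by x + g,
  -- so u ~ v in Γ + g iff (u - g) ~ (v - g) in Γ.
  _+ᵀ_ : Graph Carrier → Carrier → Graph Carrier
  (Γ +ᵀ g) u v = Γ (u - g) (v - g)

IsOneFactor : {X : Set} → Graph X → Graph X → Set
IsOneFactor {X} Γ F = (∀ x y → F x y → F y x)
                    × (F ⊆ᴱ Γ)
                    × (∀ x → ∃! _≡_ (F x))

-- A 1-factorization of Γ: a set of 1-factors (indexed by a type I; two
-- indices denote the same factor iff they have the same edge set) whose edge
-- sets partition the edge set of Γ.
record OneFactorization {X : Set} (Γ : Graph X) : Set₁ where
  field
    Idx      : Set
    factor   : Idx → Graph X
    isFactor : ∀ i → IsOneFactor Γ (factor i)
    covers   : ∀ x y → Γ x y → ∃[ i ] factor i x y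
    disjoint : ∀ i j x y → factor i x y → factor j x y → factor i ≐ᴱ factor j

open OneFactorization public

IsRegular : (X : Grp) {Γ : Graph (Grp.Carrier X)} → OneFactorization Γ → Set
IsRegular X 𝓕 = ∀ i g → ∃[ j ] (factor 𝓕 j ≐ᴱ _+ᵀ_ X (factor 𝓕 i) g)

-- 𝓖 (on vertex set X) contains 𝓗 (on vertex set Y, identified with a subset
-- of X via ι) as a subfactorization: for every F ∈ 𝓗 and Γ ∈ 𝓖, either
-- F ⊆ Γ or F and Γ share no edge; stated as "if they share an edge then F ⊆ Γ".
ContainsSub : {X Y : Set} (ι : Y → X) {Γ : Graph X} {Δ : Graph Y}
            → OneFactorization Γ → OneFactorization Δ → Set
ContainsSub ι 𝓖 𝓗 =
  ∀ i j → (∃[ x ] ∃[ y ] (factor 𝓗 i x y × factor 𝓖 j (ι x) (ι y)))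
        → ∀ x y → factor 𝓗 i x y → factor 𝓖 j (ι x) (ι y)

-- In G = G₁ × H the edges of Cay[G : H ∖ K] never leave a coset {a} × H, and
-- each coset is a copy of Cay[H : H ∖ K].  Copying every factor F ∈ 𝓗 to all
-- cosets at once therefore gives a 1-factorization of Cay[G : H ∖ K].
-- Translating by (c , k) turns the copy of F into the copy of F + k, so
-- H-regularity of 𝓗 gives G-regularity, and on the coset {0} × H the copy of
-- F is F itself, which gives the subfactorization property.
module Submission where

open import Defs
open import Data.Product using (Σ; _×_; _,_; proj₁; proj₂)
open import Relation.Binary.PropositionalEquality
open import Relation.Nullary using (¬_)
open import Level using (0ℓ)
open import Algebra.Bundles using (Group)
import Algebra.Properties.Group as GroupProperties

⊆ᴱ-trans : {X : Set} {Γ Δ Θ : Graph X} → Γ ⊆ᴱ Δ → Δ ⊆ᴱ Θ → Γ ⊆ᴱ Θ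
⊆ᴱ-trans Γ⊆Δ Δ⊆Θ x y Γxy = Δ⊆Θ x y (Γ⊆Δ x y Γxy)

≐ᴱ-trans : {X : Set} {Γ Δ Θ : Graph X} → Γ ≐ᴱ Δ → Δ ≐ᴱ Θ → Γ ≐ᴱ Θ
≐ᴱ-trans (Γ⊆Δ , Δ⊆Γ) (Δ⊆Θ , Θ⊆Δ) = ⊆ᴱ-trans Γ⊆Δ Δ⊆Θ , ⊆ᴱ-trans Θ⊆Δ Δ⊆Γ

copies : (A : Set) {Y : Set} → Graph Y → Graph (A × Y)
copies A Γ (a , y) (a' , y') = (a ≡ a') × Γ y y'

module _ {A Y : Set} where

  copies-⊆ : {Γ Δ : Graph Y} → Γ ⊆ᴱ Δ → copies A Γ ⊆ᴱ copies A Δ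
  copies-⊆ Γ⊆Δ (a , y) (a' , y') (a≡a' , Γyy') = a≡a' , Γ⊆Δ y y' Γyy'

  copies-≐ : {Γ Δ : Graph Y} → Γ ≐ᴱ Δ → copies A Γ ≐ᴱ copies A Δ
  copies-≐ (Γ⊆Δ , Δ⊆Γ) = copies-⊆ Γ⊆Δ , copies-⊆ Δ⊆Γ

  copies-isOneFactor : {Γ F : Graph Y} → IsOneFactor Γ F → IsOneFactor (copies A Γ) (copies A F)
  copies-isOneFactor {F = F} (symmetric , F⊆Γ , perfect) =
    copies-symmetric , copies-⊆ F⊆Γ , copies-perfect
    where
      copies-symmetric : ∀ u v → copies A F u v → copies A F v u
      copies-symmetric (a , y) (a' , y') (a≡a' , Fyy') = sym a≡a' , symmetric y y' Fyy'

      copies-perfect : ∀ u → Σ (A × Y) λ v → copies A F u v × (∀ {w} → copies A F u w → v ≡ w)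
      copies-perfect (a , y) with perfect y
      ... | y' , Fyy' , unique =
        (a , y') , (refl , Fyy') , λ { (a≡a'' , Fyy'') → cong₂ _,_ a≡a'' (unique Fyy'') }

  copiesFactorization : {Γ : Graph Y} → OneFactorization Γ → OneFactorization (copies A Γ)
  copiesFactorization 𝓕 = record
    { Idx      = Idx 𝓕
    ; factor   = λ i → copies A (factor 𝓕 i)
    ; isFactor = λ i → copies-isOneFactor (isFactor 𝓕 i)
    ; covers   = λ { (a , y) (a' , y') (a≡a' , Γyy') →
                     let (i , Fiyy') = covers 𝓕 y y' Γyy' in i , a≡a' , Fiyy' }
    ; disjoint = λ { i j (a , y) (a' , y') (_ , Fiyy') (_ , Fjyy') →
                     copies-≐ (disjoint 𝓕 i j y y' Fiyy' Fjyy') }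
    }

  copiesFactorization-containsSub : {Γ : Graph Y} (𝓕 : OneFactorization Γ) (a : A)
                                  → ContainsSub (a ,_) (copiesFactorization 𝓕) 𝓕
  copiesFactorization-containsSub 𝓕 a i j (y₀ , y₀' , Fiy₀y₀' , (_ , Fjy₀y₀')) y y' Fiyy' =
    refl , proj₁ (disjoint 𝓕 i j y₀ y₀' Fiy₀y₀' Fjy₀y₀') y y' Fiyy'

OneFactorization-resp-≐ : {X : Set} {Γ Δ : Graph X} → Γ ≐ᴱ Δ → OneFactorization Γ → OneFactorization Δ
OneFactorization-resp-≐ (Γ⊆Δ , Δ⊆Γ) 𝓕 = record
  { Idx      = Idx 𝓕
  ; factor   = factor 𝓕
  ; isFactor = λ i → let (symmetric , F⊆Γ , perfect) = isFactor 𝓕 i in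
                     symmetric , ⊆ᴱ-trans F⊆Γ Γ⊆Δ , perfect
  ; covers   = λ x y Δxy → covers 𝓕 x y (Δ⊆Γ x y Δxy)
  ; disjoint = disjoint 𝓕
  }

asGroup : Grp → Group 0ℓ 0ℓ
asGroup A = record { isGroup = Grp.isGroup A }

module _ (G₁ H : Grp) where
  private
    module G₁ = Grp G₁
    open GroupProperties (asGroup G₁) using (x∙y⁻¹≈ε⇒x≈y; x≈y⇒x∙y⁻¹≈ε; ∙-cancelʳ)

  copies≐cay-product : (S : Grp.Carrier H → Set)
                     → copies G₁.Carrier (Cay H S) ≐ᴱ Cay (G₁ ×ᴳ H) (λ g → (proj₁ g ≡ G₁.𝟘) × S (proj₂ g))
  copies≐cay-product S =
      (λ { (a , _) (a' , _) (a≡a' , s) → x≈y⇒x∙y⁻¹≈ε a≡a' , s })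
    , (λ { (a , _) (a' , _) (a-a'≡0 , s) → x∙y⁻¹≈ε⇒x≈y a a' a-a'≡0 , s })

  copies-+ᵀ : (F : Graph (Grp.Carrier H)) (c : G₁.Carrier) (k : Grp.Carrier H)
            → copies G₁.Carrier (_+ᵀ_ H F k) ≐ᴱ _+ᵀ_ (G₁ ×ᴳ H) (copies G₁.Carrier F) (c , k)
  copies-+ᵀ F c k =
      (λ { (a , _) (a' , _) (a≡a' , Fhh') → cong (G₁._- c) a≡a' , Fhh' })
    , (λ { (a , _) (a' , _) (a-c≡a'-c , Fhh') → ∙-cancelʳ (G₁.- c) a a' a-c≡a'-c , Fhh' })

  copiesFactorization-isRegular : {Γ : Graph (Grp.Carrier H)} (𝓕 : OneFactorization Γ) → IsRegular H 𝓕
                                → IsRegular (G₁ ×ᴳ H) (copiesFactorization {G₁.Carrier} 𝓕)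
  copiesFactorization-isRegular 𝓕 regular i (c , k) =
    let (j , Fj≐Fi+k) = regular i k
    in j , ≐ᴱ-trans (copies-≐ Fj≐Fi+k) (copies-+ᵀ (factor 𝓕 i) c k)

lemma5p1 : (H : Grp) (K : Grp.Carrier H → Set)
    → IsConnectionSet H (λ h → ¬ K h)
    → (𝓗 : OneFactorization (Cay H (λ h → ¬ K h)))
    → IsRegular H 𝓗
    → (G₁ : Grp)
    → Σ (OneFactorization (Cay (G₁ ×ᴳ H) (λ g → (Σ.proj₁ g ≡ Grp.𝟘 G₁) × ¬ K (Σ.proj₂ g))))
    (λ 𝓖 → IsRegular (G₁ ×ᴳ H) 𝓖 × ContainsSub (ι₂ G₁ H) 𝓖 𝓗)
-- The connection-set hypothesis only makes Cay[H : H ∖ K] a simple graph;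
-- the construction does not need it.
lemma5p1 H K _ 𝓗 regular G₁ =
    OneFactorization-resp-≐ (copies≐cay-product G₁ H (λ h → ¬ K h)) (copiesFactorization 𝓗)
  , copiesFactorization-isRegular G₁ H 𝓗 regular
  , copiesFactorization-containsSub 𝓗 (Grp.𝟘 G₁)
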